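{- Let $n\ge1$, $d$ a positive divisor of $n$, and on $\mathbb{Z}_2^n$ let $C$ be the cyclic shift $C(x_0,\dots,x_{n-1})=(x_1,\dots,x_{n-1},x_0)$, $R$ the reversal $R(y_0,\dots,y_{n-1})=(y_{n-1},\dots,y_0)$, and $\delta_a$ ($a\in\mathbb{Z}_n^*$) the decimation $(\delta_aY)_i=y_{ai\bmod n}$. Let $X=(-1,+1,\dots,+1)$, $A_{i,d}X=\prod_{j=0}^{n/d-1}C^{i+jd}X$ for $0\le i\le d-1$, and $\mathbb{G}_d(n)$ the subgroup generated by $\{A_{0,d}X,\dots,A_{d-1,d}X\}$. Then $\mathbb{G}_d(n)$ is an $S$-subgroup of the Schur ring $\mathfrak{S}(\mathbb{Z}_2^n,H_n\Delta_nC_n)$, i.e. it is a union of orbits of the group generated by $R$, $C$ and all $\delta_a$.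
   Context: $\mathbb{Z}_2^n$ is the group of $\pm1$ sequences of length $n$ under coordinatewise multiplication. $H_n=\{1,R\}$, $\Delta_n=\{\delta_a:a\in\mathbb{Z}_n^*\}$, $C_n=\langle C\rangle$; $\mathfrak{S}(\mathbb{Z}_2^n,G)$ is the Schur ring whose basic sets are the orbits of the coordinate-permutation group $G$; an $S$-subgroup is a subgroup that is a union of basic sets. -}

module Defs where

open import Data.Nat using (ℕ; zero; suc; _+_; _*_; _∸_; _<_; _≡ᵇ_; NonZero)
open import Data.Nat.DivMod using (_mod_; _/_)
open import Data.Nat.Coprimality using (Coprime)
open import Data.Fin using (Fin; toℕ)
open import Data.Vec using (Vec; tabulate; lookup; zipWith; replicate)
open import Data.List using (List; foldr; map; upTo)
open import Data.Sign using (Sign) renaming (_*_ to _·_)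
open import Data.Bool using (if_then_else_)

Z2 : ℕ → Set
Z2 n = Vec Sign n

_⊙_ : ∀ {n} → Z2 n → Z2 n → Z2 n
x ⊙ y = zipWith _·_ x y

𝟙 : ∀ {n} → Z2 n
𝟙 = replicate _ Sign.+

at : ∀ {n} .{{_ : NonZero n}} → Z2 n → ℕ → Sign
at {n} x k = lookup x (k mod n)

C : ∀ {n} .{{_ : NonZero n}} → Z2 n → Z2 n
C x = tabulate λ m → at x (toℕ m + 1)

R : ∀ {n} .{{_ : NonZero n}} → Z2 n → Z2 n
R {n} y = tabulate λ m → at y (n ∸ 1 ∸ toℕ m)

δ : ∀ {n} .{{_ : NonZero n}} → ℕ → Z2 n → Z2 n
δ a y = tabulate λ i → at y (a * toℕ i)

Unit : ℕ → ℕ → Set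
Unit n a = a < n Data.Product.× Coprime a n
  where import Data.Product

Cpow : ∀ {n} .{{_ : NonZero n}} → ℕ → Z2 n → Z2 n
Cpow zero x = x
Cpow (suc k) x = C (Cpow k x)

X : ∀ {n} → Z2 n
X = tabulate λ m → if toℕ m ≡ᵇ 0 then Sign.- else Sign.+

A : ∀ n .{{_ : NonZero n}} (d : ℕ) .{{_ : NonZero d}} → ℕ → Z2 n
A n d i = foldr _⊙_ 𝟙 (map (λ j → Cpow (i + j * d) X) (upTo (n / d)))

data 𝔾 (n : ℕ) .{{_ : NonZero n}} (d : ℕ) .{{_ : NonZero d}} : Z2 n → Set where
  unit : 𝔾 n d 𝟙
  gen  : ∀ i → i < d → 𝔾 n d (A n d i)
  mul  : ∀ {x y} → 𝔾 n d x → 𝔾 n d y → 𝔾 n d (x ⊙ y)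

data SameOrbit (n : ℕ) .{{_ : NonZero n}} : Z2 n → Z2 n → Set where
  orefl  : ∀ {x} → SameOrbit n x x
  osym   : ∀ {x y} → SameOrbit n x y → SameOrbit n y x
  otrans : ∀ {x y z} → SameOrbit n x y → SameOrbit n y z → SameOrbit n x z
  byC    : ∀ x → SameOrbit n x (C x)
  byR    : ∀ x → SameOrbit n x (R x)
  byδ    : ∀ a → Unit n a → ∀ x → SameOrbit n x (δ a x)

IsUnionOfOrbits : (n : ℕ) .{{_ : NonZero n}} → (Z2 n → Set) → Set
IsUnionOfOrbits n S = ∀ x y → S x → SameOrbit n x y → S y

-- 𝔾_d(n) is exactly the set of d-periodic vectors, those whose k-th coordinate depends only on
-- k mod d: A_{i,d}X is −1 precisely at the coordinates k ≡ −i (mod d), so the generators are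
-- the indicator vectors of the residue classes mod d and every periodic vector is a product of
-- them. Because d ∣ n, each of C, R and δ_a (a a unit mod n) acts by a coordinate map that
-- preserves congruence mod d, and so does its inverse (C^{n−1}, R, δ_{a⁻¹}); hence periodicity
-- is invariant under the group they generate.

module Submission where

open import Defs
open import Data.Nat
  using (ℕ; NonZero; >-nonZero⁻¹; zero; suc; _+_; _*_; _∸_; _<_; _≤_; _%_; _/_; _≡ᵇ_; s≤s; z<s; s<s)
open import Data.Nat.Properties
open import Data.Nat.DivMod hiding (_mod_)
import Data.Nat.DivMod as DivMod
open import Data.Nat.Divisibility using (_∣_; n∣m*n; ∣m⇒∣m*n)
open import Data.Nat.Coprimality using (Coprime; coprime-Bézout)
open import Data.Nat.GCD using (module Bézout)
open import Data.Nat.Tactic.RingSolver using (solve-∀)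
open import Data.Fin using (Fin; toℕ)
open import Data.Fin.Properties using (toℕ-injective; toℕ-fromℕ<; toℕ<n)
open import Data.Vec using (lookup; tabulate)
open import Data.Vec.Properties
  using (lookup-zipWith; lookup∘tabulate; lookup-replicate; tabulate∘lookup; tabulate-cong)
open import Data.List using (foldr; map; applyUpTo; upTo)
open import Data.Sign using (Sign) renaming (_*_ to _·_)
open import Data.Sign.Properties using ()
  renaming (*-identityʳ to ·-identityʳ; *-comm to ·-comm; *-assoc to ·-assoc;
            *-cancelˡ-≡ to ·-cancelˡ-≡)
open import Data.Bool using (if_then_else_)
open import Data.Product using (∃-syntax; _×_; _,_)
open import Data.Empty using (⊥-elim)
open import Function using (id; _∘_; _⇔_; mk⇔; Equivalence)
open import Function.Construct.Identity using (⇔-id)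
open import Function.Construct.Symmetry using (⇔-sym)
open import Function.Construct.Composition using (_⇔-∘_)
open import Relation.Binary.PropositionalEquality

infix 4 _≡_mod_

record _≡_mod_ (a b d : ℕ) .{{_ : NonZero d}} : Set where
  constructor ≡-mod
  field residue-≡ : a % d ≡ b % d

open _≡_mod_

module _ {d : ℕ} .{{_ : NonZero d}} where

  %-mod : ∀ a → a % d ≡ a mod d
  %-mod a = ≡-mod (m%n%n≡m%n a d)

  mod-sym : ∀ {a b} → a ≡ b mod d → b ≡ a mod d
  mod-sym (≡-mod a≡b) = ≡-mod (sym a≡b)

  mod-trans : ∀ {a b c} → a ≡ b mod d → b ≡ c mod d → a ≡ c mod d
  mod-trans (≡-mod a≡b) (≡-mod b≡c) = ≡-mod (trans a≡b b≡c)

  +-congʳ-mod : ∀ {a b} c → a ≡ b mod d → a + c ≡ b + c mod d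
  +-congʳ-mod {a} {b} c (≡-mod a≡b) = ≡-mod (begin
    (a + c) % d          ≡⟨ %-distribˡ-+ a c d ⟩
    (a % d + c % d) % d  ≡⟨ cong (λ r → (r + c % d) % d) a≡b ⟩
    (b % d + c % d) % d  ≡⟨ %-distribˡ-+ b c d ⟨
    (b + c) % d          ∎)
    where open ≡-Reasoning

  +-congˡ-mod : ∀ c {a b} → a ≡ b mod d → c + a ≡ c + b mod d
  +-congˡ-mod c {a} {b} a≡b = subst₂ (_≡_mod d) (+-comm a c) (+-comm b c) (+-congʳ-mod c a≡b)

  *-congˡ-mod : ∀ c {a b} → a ≡ b mod d → c * a ≡ c * b mod d
  *-congˡ-mod c {a} {b} (≡-mod a≡b) = ≡-mod (begin
    (c * a) % d            ≡⟨ %-distribˡ-* c a d ⟩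
    (c % d * (a % d)) % d  ≡⟨ cong (λ r → (c % d * r) % d) a≡b ⟩
    (c % d * (b % d)) % d  ≡⟨ %-distribˡ-* c b d ⟨
    (c * b) % d            ∎)
    where open ≡-Reasoning

  *-congʳ-mod : ∀ {a b} c → a ≡ b mod d → a * c ≡ b * c mod d
  *-congʳ-mod {a} {b} c a≡b = subst₂ (_≡_mod d) (*-comm c a) (*-comm c b) (*-congˡ-mod c a≡b)

  <-mod-injective : ∀ {i j} → i < d → j < d → i ≡ j mod d → i ≡ j
  <-mod-injective i<d j<d (≡-mod i≡j) = trans (sym (m<n⇒m%n≡m i<d)) (trans i≡j (m<n⇒m%n≡m j<d))

-- Adding c·(d − 1) to a + c gives a + c·d ≡ a.
+-cancelʳ-mod : ∀ {a b d} .{{_ : NonZero d}} c → a + c ≡ b + c mod d → a ≡ b mod d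
+-cancelʳ-mod {a} {b} {suc d'} c a+c≡b+c =
  mod-trans (mod-sym (unshift a)) (mod-trans (+-congʳ-mod (c * d') a+c≡b+c) (unshift b))
  where
  unshift : ∀ x → x + c + c * d' ≡ x mod suc d'
  unshift x = ≡-mod (trans (cong (_% suc d') (trans (+-assoc x c (c * d')) (cong (x +_) (sym (*-suc c d')))))
                           ([m+kn]%n≡m%n x c (suc d')))

∸-congˡ-mod : ∀ {d} .{{_ : NonZero d}} {m u v} → u ≤ m → v ≤ m → u ≡ v mod d → m ∸ u ≡ m ∸ v mod d
∸-congˡ-mod {d} {m} {u} {v} u≤m v≤m u≡v = +-cancelʳ-mod u
  (subst (λ t → t ≡ m ∸ v + u mod d) (trans (m∸n+n≡m v≤m) (sym (m∸n+n≡m u≤m)))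
         (+-congˡ-mod (m ∸ v) (mod-sym u≡v)))

∃!-complement-mod : ∀ d .{{_ : NonZero d}} k →
  ∃[ i ] i < d × (k + i) % d ≡ 0 × (∀ {j} → j < d → (k + j) % d ≡ 0 → j ≡ i)
∃!-complement-mod d k = i , m%n<n (d ∸ k % d) d , k+i≡0 , unique
  where
  open ≡-Reasoning
  i : ℕ
  i = (d ∸ k % d) % d
  k+i≡0 : (k + i) % d ≡ 0
  k+i≡0 = begin
    (k + i) % d                ≡⟨ residue-≡ (+-congˡ-mod k (%-mod (d ∸ k % d))) ⟩
    (k + (d ∸ k % d)) % d      ≡⟨ residue-≡ (+-congʳ-mod (d ∸ k % d) (%-mod k)) ⟨
    (k % d + (d ∸ k % d)) % d  ≡⟨ cong (_% d) (m+[n∸m]≡n (<⇒≤ (m%n<n k d))) ⟩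
    d % d                      ≡⟨ n%n≡0 d ⟩
    0                          ∎
  unique : ∀ {j} → j < d → (k + j) % d ≡ 0 → j ≡ i
  unique {j} j<d k+j≡0 = <-mod-injective j<d (m%n<n (d ∸ k % d) d)
    (+-cancelʳ-mod k (subst₂ (_≡_mod d) (+-comm k j) (+-comm k i) (≡-mod (trans k+j≡0 (sym k+i≡0)))))

inverse-mod : ∀ {n} .{{_ : NonZero n}} {a} → Coprime a n → ∃[ b ] a * b ≡ 1 mod n
inverse-mod {suc m} {a} a⊥n with coprime-Bézout a⊥n
... | Bézout.+- x y 1+yn≡xa = x , ≡-mod (begin
  (a * x) % n      ≡⟨ cong (_% n) (trans (*-comm a x) (sym 1+yn≡xa)) ⟩
  (1 + y * n) % n  ≡⟨ [m+kn]%n≡m%n 1 y n ⟩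
  1 % n            ∎)
  where
  open ≡-Reasoning
  n = suc m
... | Bézout.-+ x y 1+xa≡yn = x * m , ≡-mod (begin
  (a * (x * m)) % n          ≡⟨ [m+n]%n≡m%n (a * (x * m)) n ⟨
  (a * (x * m) + n) % n      ≡⟨ cong (_% n) (identity a x m) ⟩
  ((1 + x * a) * m + 1) % n  ≡⟨ cong (λ t → (t * m + 1) % n) 1+xa≡yn ⟩
  (y * n * m + 1) % n        ≡⟨ %-remove-+ˡ 1 (∣m⇒∣m*n m (n∣m*n y)) ⟩
  1 % n                      ∎)
  where
  open ≡-Reasoning
  n = suc m
  identity : ∀ a x m → a * (x * m) + suc m ≡ (1 + x * a) * m + 1
  identity = solve-∀

Π : (ℕ → Sign) → ℕ → Sign
Π g zero    = Sign.+
Π g (suc N) = g 0 · Π (g ∘ suc) N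

Π-cong : ∀ {g h} N → g ≗ h → Π g N ≡ Π h N
Π-cong zero    g≗h = refl
Π-cong (suc N) g≗h = cong₂ _·_ (g≗h 0) (Π-cong N (g≗h ∘ suc))

Π-snoc : ∀ g N → Π g (suc N) ≡ Π g N · g N
Π-snoc g zero    = ·-identityʳ (g 0)
Π-snoc g (suc N) = trans (cong (g 0 ·_) (Π-snoc (g ∘ suc) N)) (sym (·-assoc (g 0) _ _))

Π-rotate : ∀ g N → g N ≡ g 0 → Π (g ∘ suc) N ≡ Π g N
Π-rotate g N gN≡g0 = ·-cancelˡ-≡ (g 0) _ _ (begin
  g 0 · Π (g ∘ suc) N  ≡⟨ Π-snoc g N ⟩
  Π g N · g N          ≡⟨ cong (Π g N ·_) gN≡g0 ⟩
  Π g N · g 0          ≡⟨ ·-comm (Π g N) (g 0) ⟩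
  g 0 · Π g N          ∎)
  where open ≡-Reasoning

Π-all+ : ∀ g N → (∀ {j} → j < N → g j ≡ Sign.+) → Π g N ≡ Sign.+
Π-all+ g zero    all+ = refl
Π-all+ g (suc N) all+ = cong₂ _·_ (all+ z<s) (Π-all+ (g ∘ suc) N (all+ ∘ s<s))

Π-single : ∀ g N {i} → i < N → (∀ {j} → j < N → j ≢ i → g j ≡ Sign.+) → Π g N ≡ g i
Π-single g (suc N) {zero} i<N others =
  trans (cong (g 0 ·_) (Π-all+ (g ∘ suc) N (λ j<N → others (s<s j<N) λ ()))) (·-identityʳ (g 0))
Π-single g (suc N) {suc i} (s<s i<N) others =
  cong₂ _·_ (others z<s λ ())
            (Π-single (g ∘ suc) N i<N (λ j<N j≢i → others (s<s j<N) (j≢i ∘ suc-injective)))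

module _ {n : ℕ} .{{_ : NonZero n}} where

  at-cong : (x : Z2 n) {k k' : ℕ} → k ≡ k' mod n → at x k ≡ at x k'
  at-cong x k≡k' =
    cong (lookup x) (toℕ-injective (trans (toℕ-fromℕ< _) (trans (residue-≡ k≡k') (sym (toℕ-fromℕ< _)))))

  at-toℕ : (x : Z2 n) (i : Fin n) → at x (toℕ i) ≡ lookup x i
  at-toℕ x i = cong (lookup x) (toℕ-injective (trans (toℕ-fromℕ< _) (m<n⇒m%n≡m (toℕ<n i))))

  at-injective : {x y : Z2 n} → (∀ k → at x k ≡ at y k) → x ≡ y
  at-injective {x} {y} x≗y = begin
    x                    ≡⟨ tabulate∘lookup x ⟨
    tabulate (lookup x)  ≡⟨ tabulate-cong (λ i → trans (sym (at-toℕ x i)) (trans (x≗y (toℕ i)) (at-toℕ y i))) ⟩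
    tabulate (lookup y)  ≡⟨ tabulate∘lookup y ⟩
    y                    ∎
    where open ≡-Reasoning

  at-tabulate : (f : ℕ → Sign) (k : ℕ) → at {n} (tabulate (f ∘ toℕ)) k ≡ f (k % n)
  at-tabulate f k = trans (lookup∘tabulate (f ∘ toℕ) (k DivMod.mod n)) (cong f (toℕ-fromℕ< _))

  at-⊙ : (x y : Z2 n) (k : ℕ) → at (x ⊙ y) k ≡ at x k · at y k
  at-⊙ x y k = lookup-zipWith _·_ (k DivMod.mod n) x y

  at-𝟙 : (k : ℕ) → at {n} 𝟙 k ≡ Sign.+
  at-𝟙 k = lookup-replicate (k DivMod.mod n) Sign.+

  at-∏ : (f : ℕ → Z2 n) (φ : ℕ → ℕ) (N k : ℕ) →
         at (foldr _⊙_ 𝟙 (map f (applyUpTo φ N))) k ≡ Π (λ j → at (f (φ j)) k) N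
  at-∏ f φ zero    k = at-𝟙 k
  at-∏ f φ (suc N) k = trans (at-⊙ (f (φ 0)) _ k) (cong (at (f (φ 0)) k ·_) (at-∏ f (φ ∘ suc) N k))

  at-C : (x : Z2 n) (k : ℕ) → at (C x) k ≡ at x (k % n + 1)
  at-C x = at-tabulate (λ r → at x (r + 1))

  at-R : (x : Z2 n) (k : ℕ) → at (R x) k ≡ at x (n ∸ 1 ∸ k % n)
  at-R x = at-tabulate (λ r → at x (n ∸ 1 ∸ r))

  at-δ : (a : ℕ) (x : Z2 n) (k : ℕ) → at (δ a x) k ≡ at x (a * (k % n))
  at-δ a x = at-tabulate (λ r → at x (a * r))

  at-Cpow : (c : ℕ) (x : Z2 n) (k : ℕ) → at (Cpow c x) k ≡ at x (k + c)
  at-Cpow zero    x k = cong (at x) (sym (+-identityʳ k))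
  at-Cpow (suc c) x k = begin
    at (C (Cpow c x)) k        ≡⟨ at-C (Cpow c x) k ⟩
    at (Cpow c x) (k % n + 1)  ≡⟨ at-Cpow c x (k % n + 1) ⟩
    at x (k % n + 1 + c)       ≡⟨ at-cong x (+-congʳ-mod c (+-congʳ-mod 1 (%-mod k))) ⟩
    at x (k + 1 + c)           ≡⟨ cong (at x) (+-assoc k 1 c) ⟩
    at x (k + suc c)           ∎
    where open ≡-Reasoning

  private
    at-X : ∀ {t} → t < n → at {n} X t ≡ (if t ≡ᵇ 0 then Sign.- else Sign.+)
    at-X {t} t<n = trans (at-tabulate (λ r → if r ≡ᵇ 0 then Sign.- else Sign.+) t)
                         (cong (λ r → if r ≡ᵇ 0 then Sign.- else Sign.+) (m<n⇒m%n≡m t<n))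

  at-X-0 : at {n} X 0 ≡ Sign.-
  at-X-0 = at-X (>-nonZero⁻¹ n)

  at-X-pos : ∀ {t} → 0 < t → t < n → at {n} X t ≡ Sign.+
  at-X-pos {suc t} _ t<n = at-X t<n

Periodic : ∀ {n} .{{_ : NonZero n}} (d : ℕ) .{{_ : NonZero d}} → Z2 n → Set
Periodic d x = ∀ {k k'} → k ≡ k' mod d → at x k ≡ at x k'

RespectsMod : (d : ℕ) .{{_ : NonZero d}} → (ℕ → ℕ) → Set
RespectsMod d h = ∀ {k k'} → k ≡ k' mod d → h k ≡ h k' mod d

module _ {n d : ℕ} .{{_ : NonZero n}} .{{_ : NonZero d}} where

  periodic-reindex : (x y : Z2 n) (h : ℕ → ℕ) → RespectsMod d h →
                     (∀ k → at y k ≡ at x (h k)) → Periodic d x → Periodic d y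
  periodic-reindex x y h h-resp y≗x∘h x-per {k} {k'} k≡k' =
    trans (y≗x∘h k) (trans (x-per (h-resp k≡k')) (sym (y≗x∘h k')))

  periodic-⇔ : (x y : Z2 n) (h h' : ℕ → ℕ) → RespectsMod d h → RespectsMod d h' →
               (∀ k → at y k ≡ at x (h k)) → (∀ k → at x k ≡ at y (h' k)) →
               Periodic d x ⇔ Periodic d y
  periodic-⇔ x y h h' h-resp h'-resp y≗x∘h x≗y∘h' =
    mk⇔ (periodic-reindex x y h h-resp y≗x∘h) (periodic-reindex y x h' h'-resp x≗y∘h')

  ∏-∈𝔾 : (f : ℕ → Z2 n) (φ : ℕ → ℕ) (N : ℕ) → (∀ {j} → j < N → 𝔾 n d (f (φ j))) →
         𝔾 n d (foldr _⊙_ 𝟙 (map f (applyUpTo φ N)))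
  ∏-∈𝔾 f φ zero    members = unit
  ∏-∈𝔾 f φ (suc N) members = mul (members z<s) (∏-∈𝔾 f (φ ∘ suc) N (members ∘ s<s))

ifZero : Sign → ℕ → Sign
ifZero s zero    = s
ifZero s (suc _) = Sign.+

ifZero-≢0 : ∀ s {r} → r ≢ 0 → ifZero s r ≡ Sign.+
ifZero-≢0 s {zero}  r≢0 = ⊥-elim (r≢0 refl)
ifZero-≢0 s {suc r} r≢0 = refl

ifZero-+ : ∀ r → ifZero Sign.+ r ≡ Sign.+
ifZero-+ zero    = refl
ifZero-+ (suc r) = refl

module OrbitInvariance {n' d : ℕ} .{{_ : NonZero d}} (d∣n : d ∣ suc n') where

  private
    n : ℕ
    n = suc n'

  %n-respects : RespectsMod d (_% n)
  %n-respects {k} {k'} (≡-mod k≡k') =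
    ≡-mod (trans (m∣n⇒o%n%m≡o%m d n k d∣n) (trans k≡k' (sym (m∣n⇒o%n%m≡o%m d n k' d∣n))))

  periodic-C : (x : Z2 n) → Periodic d x ⇔ Periodic d (C x)
  periodic-C x = periodic-⇔ x (C x) (λ k → k % n + 1) (λ k → k + n')
    (+-congʳ-mod 1 ∘ %n-respects) (+-congʳ-mod n') (at-C x) C⁻¹
    where
    C⁻¹ : ∀ k → at x k ≡ at (C x) (k + n')
    C⁻¹ k = begin
      at x k                   ≡⟨ at-cong x {k + n} {k} (≡-mod ([m+n]%n≡m%n k n)) ⟨
      at x (k + n)             ≡⟨ cong (at x) (trans (+-suc k n') (+-comm 1 (k + n'))) ⟩
      at x (k + n' + 1)        ≡⟨ at-cong x (+-congʳ-mod 1 (%-mod (k + n'))) ⟨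
      at x ((k + n') % n + 1)  ≡⟨ at-C x (k + n') ⟨
      at (C x) (k + n')        ∎
      where open ≡-Reasoning

  private
    %n≤n' : ∀ k → k % n ≤ n'
    %n≤n' k = ≤-pred (m%n<n k n)

  periodic-R : (x : Z2 n) → Periodic d x ⇔ Periodic d (R x)
  periodic-R x = periodic-⇔ x (R x) reflect reflect reflect-respects reflect-respects (at-R x) R⁻¹
    where
    reflect : ℕ → ℕ
    reflect k = n' ∸ k % n
    reflect-respects : RespectsMod d reflect
    reflect-respects {k} {k'} k≡k' = ∸-congˡ-mod (%n≤n' k) (%n≤n' k') (%n-respects k≡k')
    R⁻¹ : ∀ k → at x k ≡ at (R x) (reflect k)
    R⁻¹ k = begin
      at x k                          ≡⟨ at-cong x (%-mod k) ⟨
      at x (k % n)                    ≡⟨ cong (at x) (m∸[m∸n]≡n (%n≤n' k)) ⟨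
      at x (n' ∸ (n' ∸ k % n))        ≡⟨ cong (λ r → at x (n' ∸ r)) (m<n⇒m%n≡m (s≤s (m∸n≤m n' (k % n)))) ⟨
      at x (n' ∸ (n' ∸ k % n) % n)    ≡⟨ at-R x (reflect k) ⟨
      at (R x) (reflect k)            ∎
      where open ≡-Reasoning

  periodic-δ : ∀ a → Unit n a → (x : Z2 n) → Periodic d x ⇔ Periodic d (δ a x)
  periodic-δ a (_ , a⊥n) x with inverse-mod a⊥n
  ... | b , ab≡1 = periodic-⇔ x (δ a x) (λ k → a * (k % n)) (b *_)
    (*-congˡ-mod a ∘ %n-respects) (*-congˡ-mod b) (at-δ a x) δ⁻¹
    where
    δ⁻¹ : ∀ k → at x k ≡ at (δ a x) (b * k)
    δ⁻¹ k = begin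
      at x k                    ≡⟨ at-cong x (mod-sym index≡k) ⟩
      at x (a * ((b * k) % n))  ≡⟨ at-δ a x (b * k) ⟨
      at (δ a x) (b * k)        ∎
      where
      open ≡-Reasoning
      index≡k : a * ((b * k) % n) ≡ k mod n
      index≡k = mod-trans (*-congˡ-mod a (%-mod (b * k)))
                          (subst₂ (_≡_mod n) (*-assoc a b k) (*-identityˡ k) (*-congʳ-mod k ab≡1))

  sameOrbit⇒periodic⇔ : ∀ {x y} → SameOrbit n x y → Periodic d x ⇔ Periodic d y
  sameOrbit⇒periodic⇔ orefl            = ⇔-id _
  sameOrbit⇒periodic⇔ (osym x~y)       = ⇔-sym (sameOrbit⇒periodic⇔ x~y)
  sameOrbit⇒periodic⇔ (otrans x~y y~z) = sameOrbit⇒periodic⇔ y~z ⇔-∘ sameOrbit⇒periodic⇔ x~y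
  sameOrbit⇒periodic⇔ (byC x)          = periodic-C x
  sameOrbit⇒periodic⇔ (byR x)          = periodic-R x
  sameOrbit⇒periodic⇔ (byδ a a∈ℤₙ* x)  = periodic-δ a a∈ℤₙ* x

module PeriodicGeneration {n' d : ℕ} .{{_ : NonZero d}} (d∣n : d ∣ suc n') where

  private
    n : ℕ
    n = suc n'

  private
    N : ℕ
    N = n / d

    N*d≡n : N * d ≡ n
    N*d≡n = m/n*n≡m d∣n

    X-at : ℕ → Sign
    X-at = at {n} X

    classProduct : ℕ → Sign
    classProduct t = Π (λ j → X-at (t + j * d)) N

  r+jd<n : ∀ {r j M} → M * d ≡ n → r < d → j < M → r + j * d < n
  r+jd<n {r} {j} M*d≡n r<d j<M =
    subst (r + j * d <_) M*d≡n (<-≤-trans (+-monoˡ-< (j * d) r<d) (*-monoˡ-≤ d j<M))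

  Π-X-initial : ∀ {r} M → M * d ≡ n → r < d → Π (λ j → X-at (r + j * d)) M ≡ ifZero Sign.- r
  Π-X-initial {zero} (suc M) M*d≡n r<d =
    cong₂ _·_ (at-X-0 {n}) (Π-all+ (λ j → X-at (d + j * d)) M λ j<M →
      at-X-pos {n} (<-≤-trans (>-nonZero⁻¹ d) (m≤m+n d _)) (r+jd<n M*d≡n r<d (s<s j<M)))
  Π-X-initial {suc r} M M*d≡n r<d =
    Π-all+ (λ j → X-at (suc r + j * d)) M λ j<M → at-X-pos {n} z<s (r+jd<n M*d≡n r<d j<M)

  classProduct-period : ∀ t → classProduct (t + d) ≡ classProduct t
  classProduct-period t = trans (Π-cong N (λ j → cong X-at (+-assoc t d (j * d))))
                                (Π-rotate (λ j → X-at (t + j * d)) N wrap)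
    where
    wrap : X-at (t + N * d) ≡ X-at (t + 0)
    wrap = begin
      X-at (t + N * d)  ≡⟨ cong (λ m → X-at (t + m)) N*d≡n ⟩
      X-at (t + n)      ≡⟨ at-cong (X {n}) {t + n} {t} (≡-mod ([m+n]%n≡m%n t n)) ⟩
      X-at t            ≡⟨ cong X-at (+-identityʳ t) ⟨
      X-at (t + 0)      ∎
      where open ≡-Reasoning

  classProduct-+multiple : ∀ r q → classProduct (r + q * d) ≡ classProduct r
  classProduct-+multiple r zero    = cong classProduct (+-identityʳ r)
  classProduct-+multiple r (suc q) = begin
    classProduct (r + (d + q * d))  ≡⟨ cong (λ m → classProduct (r + m)) (+-comm d (q * d)) ⟩
    classProduct (r + (q * d + d))  ≡⟨ cong classProduct (+-assoc r (q * d) d) ⟨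
    classProduct (r + q * d + d)    ≡⟨ classProduct-period (r + q * d) ⟩
    classProduct (r + q * d)        ≡⟨ classProduct-+multiple r q ⟩
    classProduct r                  ∎
    where open ≡-Reasoning

  classProduct≡ifZero : ∀ t → classProduct t ≡ ifZero Sign.- (t % d)
  classProduct≡ifZero t = begin
    classProduct t                          ≡⟨ cong classProduct (m≡m%n+[m/n]*n t d) ⟩
    classProduct (t % d + (t / d) * d)      ≡⟨ classProduct-+multiple (t % d) (t / d) ⟩
    classProduct (t % d)                    ≡⟨ Π-X-initial N N*d≡n (m%n<n t d) ⟩
    ifZero Sign.- (t % d)                   ∎
    where open ≡-Reasoning

  at-A : ∀ i k → at (A n d i) k ≡ ifZero Sign.- ((k + i) % d)
  at-A i k = begin
    at (A n d i) k                          ≡⟨ at-∏ (λ j → Cpow (i + j * d) X) id N k ⟩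
    Π (λ j → at (Cpow (i + j * d) X) k) N   ≡⟨ Π-cong N (λ j → at-Cpow (i + j * d) X k) ⟩
    Π (λ j → X-at (k + (i + j * d))) N      ≡⟨ Π-cong N (λ j → cong X-at (+-assoc k i (j * d))) ⟨
    classProduct (k + i)                    ≡⟨ classProduct≡ifZero (k + i) ⟩
    ifZero Sign.- ((k + i) % d)             ∎
    where open ≡-Reasoning

  𝔾⇒periodic : ∀ {x} → 𝔾 n d x → Periodic d x
  𝔾⇒periodic unit {k} {k'} _ = trans (at-𝟙 {n} k) (sym (at-𝟙 {n} k'))
  𝔾⇒periodic (gen i _) {k} {k'} k≡k' =
    trans (at-A i k) (trans (cong (ifZero Sign.-) (residue-≡ (+-congʳ-mod i k≡k'))) (sym (at-A i k')))
  𝔾⇒periodic (mul {x} {y} x∈𝔾 y∈𝔾) {k} {k'} k≡k' =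
    trans (at-⊙ x y k)
          (trans (cong₂ _·_ (𝔾⇒periodic x∈𝔾 k≡k') (𝔾⇒periodic y∈𝔾 k≡k')) (sym (at-⊙ x y k')))

  factor : Sign → ℕ → Z2 n
  factor Sign.- i = A n d i
  factor Sign.+ i = 𝟙

  at-factor : ∀ s i k → at (factor s i) k ≡ ifZero s ((k + i) % d)
  at-factor Sign.- i k = at-A i k
  at-factor Sign.+ i k = trans (at-𝟙 {n} k) (sym (ifZero-+ ((k + i) % d)))

  factor-∈𝔾 : ∀ s {i} → i < d → 𝔾 n d (factor s i)
  factor-∈𝔾 Sign.- i<d = gen _ i<d
  factor-∈𝔾 Sign.+ i<d = unit

  -- x = ∏_{i<d} (A_{i,d}X)^[x_{d−i} = −1]: coordinate k only sees the factor with i ≡ −k (mod d).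
  reconstruct : Z2 n → Z2 n
  reconstruct x = foldr _⊙_ 𝟙 (map (λ i → factor (at x (d ∸ i)) i) (upTo d))

  at-reconstruct : (x : Z2 n) → Periodic d x → ∀ k → at (reconstruct x) k ≡ at x k
  at-reconstruct x x-per k with ∃!-complement-mod d k
  ... | i , i<d , k+i≡0 , unique = begin
    at (reconstruct x) k                        ≡⟨ at-∏ (λ j → factor (at x (d ∸ j)) j) id d k ⟩
    Π (λ j → at (factor (at x (d ∸ j)) j) k) d  ≡⟨ Π-cong d (λ j → at-factor (at x (d ∸ j)) j k) ⟩
    Π contribution d                            ≡⟨ Π-single contribution d i<d others ⟩
    ifZero (at x (d ∸ i)) ((k + i) % d)         ≡⟨ cong (ifZero (at x (d ∸ i))) k+i≡0 ⟩
    at x (d ∸ i)                                ≡⟨ x-per d∸i≡k ⟩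
    at x k                                      ∎
    where
    open ≡-Reasoning
    contribution : ℕ → Sign
    contribution j = ifZero (at x (d ∸ j)) ((k + j) % d)
    others : ∀ {j} → j < d → j ≢ i → contribution j ≡ Sign.+
    others {j} j<d j≢i = ifZero-≢0 (at x (d ∸ j)) (j≢i ∘ unique j<d)
    d∸i≡k : d ∸ i ≡ k mod d
    d∸i≡k = +-cancelʳ-mod i (≡-mod (begin
      (d ∸ i + i) % d  ≡⟨ cong (_% d) (m∸n+n≡m (<⇒≤ i<d)) ⟩
      d % d            ≡⟨ n%n≡0 d ⟩
      0                ≡⟨ k+i≡0 ⟨
      (k + i) % d      ∎))

  periodic⇒𝔾 : ∀ {x : Z2 n} → Periodic d x → 𝔾 n d x
  periodic⇒𝔾 {x} x-per = subst (𝔾 n d) (at-injective (at-reconstruct x x-per))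
    (∏-∈𝔾 (λ i → factor (at x (d ∸ i)) i) id d (λ {i} → factor-∈𝔾 (at x (d ∸ i))))

mainTheorem19 : (n : ℕ) .{{_ : NonZero n}} (d : ℕ) .{{_ : NonZero d}} → d ∣ n →
    IsUnionOfOrbits n (𝔾 n d)
mainTheorem19 (suc n') d d∣n x y x∈𝔾 x~y =
  periodic⇒𝔾 (Equivalence.to (sameOrbit⇒periodic⇔ x~y) (𝔾⇒periodic x∈𝔾))
  where
  open OrbitInvariance d∣n
  open PeriodicGeneration d∣n
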